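{- Let $G$ be a directed graph with $n$ vertices and source $s$ from which every vertex is reachable, and let $T_D^G$ be its dominator tree. Assume that no node of $T_D^G$ has outdegree exactly $1$ (exactly one child). Let $v_1,\dots,v_k$ be any sequence of distinct vertices of $G$ such that $v_i$ dominates $v_{i+1}$ for all $i$. Then $k\le(n+1)/2$.
   Context: Vertex $u$ dominates $v$ if every path from $s$ to $v$ visits $u$. Vertex $u$ immediately dominates $v\ne u$ if $u$ dominates $v$, $u\neq v$, and every other dominator of $v$ distinct from $v$ dominates $u$; every vertex other than $s$ has exactly one immediate dominator. The dominator tree $T_D^G$ is the tree on $V(G)$ rooted at $s$ in which the parent of each $v\neq s$ is its immediate dominator; $u$ is an ancestor of $v$ in $T_D^G$ iff $u$ dominates $v$. -}

module Defs where

open import Data.Nat using (ℕ)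
open import Data.Fin using (Fin)
open import Data.Product using (Σ; _×_)
open import Data.Sum using (_⊎_)
open import Relation.Binary.PropositionalEquality using (_≡_; _≢_)
open import Relation.Nullary using (¬_)

Graph : ℕ → Set₁
Graph n = Fin n → Fin n → Set

module _ {n : ℕ} (E : Graph n) where

  data Path : Fin n → Fin n → Set where
    []  : ∀ {x} → Path x x
    _∷_ : ∀ {x y z} → E x y → Path y z → Path x z

  data Visits (u : Fin n) : ∀ {x y} → Path x y → Set where
    here  : ∀ {y} {p : Path u y} → Visits u p
    there : ∀ {x y z} {e : E x y} {p : Path y z} → Visits u p → Visits u (e ∷ p)

  AllReachable : Fin n → Set
  AllReachable s = ∀ v → Path s v

  Dominates : Fin n → Fin n → Fin n → Set
  Dominates s u v = ∀ (p : Path s v) → Visits u p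

  IDom : Fin n → Fin n → Fin n → Set
  IDom s u v = Dominates s u v × u ≢ v
             × (∀ w → Dominates s w v → w ≢ v → Dominates s w u)

  ChildDT : Fin n → Fin n → Fin n → Set
  ChildDT s u c = c ≢ s × IDom s u c

  HasExactlyOneChild : Fin n → Fin n → Set
  HasExactlyOneChild s u = Σ (Fin n) λ c → ChildDT s u c × (∀ c' → ChildDT s u c' → c' ≡ c)

{-# OPTIONS --safe #-}
module Submission where

-- Each vertex v_i (i < k) strictly dominates v_{i+1}, so it has a child c_i in the dominator
-- tree that dominates v_{i+1}; since v_i does not have exactly one child, it has a second
-- child w_i. Siblings are incomparable under dominance while c_i dominates every later v_j
-- and w_j, and w_i cannot dominate its parent v_i, which every earlier v_j dominates. Hence
-- the k-1 vertices w_i are distinct and avoid the chain, giving k + (k - 1) ≤ n.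
-- Deciding dominance over arbitrary edge types is classical, but the conclusion is a
-- decidable inequality, so dominance may be assumed decidable (a double-negation shift
-- over the finitely many pairs of vertices).

open import Defs
open import Data.Nat using (ℕ; zero; suc; _+_; _*_; _≤_; _<_; _∸_; z≤n; _≤?_)
open import Data.Nat.Properties using (m∸n+n≡m; <⇒≤; 1+n≢n; ≤-<-connex; +-monoˡ-≤; module ≤-Reasoning)
open import Data.Nat.Tactic.RingSolver using (solve-∀)
open import Data.Fin using (Fin; toℕ; zero; suc; inject₁; fromℕ<; splitAt; join; _≟_)
open import Data.Fin.Properties using (toℕ-injective; toℕ<n; toℕ-fromℕ<; toℕ-inject₁; join-splitAt; any?; all?; injective⇒≤; <-cmp)
open import Data.Product using (Σ; _×_; _,_)
open import Data.Sum using (_⊎_; inj₁; inj₂; [_,_]′)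
open import Data.Empty using (⊥; ⊥-elim)
open import Function using (_∘_)
open import Function.Definitions using (Injective)
open import Relation.Binary using (Reflexive; Transitive; tri<; tri≈; tri>)
open import Relation.Binary.PropositionalEquality using (_≡_; _≢_; refl; sym; trans; cong; subst)
open import Relation.Nullary using (¬_; Dec; yes; no)
open import Relation.Nullary.Decidable using (¬?; _×-dec_; _→-dec_; _⊎-dec_; decidable-stable; ¬¬-excluded-middle)

¬¬-∀-Fin : ∀ {m} {P : Fin m → Set} → (∀ i → ¬ ¬ P i) → ¬ ¬ (∀ i → P i)
¬¬-∀-Fin {zero}  ¬¬P ¬∀P = ¬∀P λ ()
¬¬-∀-Fin {suc m} ¬¬P ¬∀P = ¬¬P zero λ P₀ → ¬¬-∀-Fin (¬¬P ∘ suc) λ Pₛ →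
  ¬∀P λ { zero → P₀ ; (suc i) → Pₛ i }

module _ {k : ℕ} {R : Fin k → Fin k → Set} (R-refl : Reflexive R) (R-trans : Transitive R)
         (R-step : ∀ i j → toℕ j ≡ suc (toℕ i) → R i j) where

  private
    steps : ∀ d i j → toℕ j ≡ d + toℕ i → R i j
    steps zero    i j j≡i = subst (R i) (sym (toℕ-injective j≡i)) R-refl
    steps (suc d) i j j≡d+i = R-trans (steps d i j′ (toℕ-fromℕ< j′<k)) (R-step j′ j j≡1+j′)
      where
      j′<k : d + toℕ i < k
      j′<k = <⇒≤ (subst (_< k) j≡d+i (toℕ<n j))
      j′ = fromℕ< j′<k
      j≡1+j′ : toℕ j ≡ suc (toℕ j′)
      j≡1+j′ = trans j≡d+i (cong suc (sym (toℕ-fromℕ< j′<k)))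

  steps⇒monotone : ∀ i j → toℕ i ≤ toℕ j → R i j
  steps⇒monotone i j i≤j = steps (toℕ j ∸ toℕ i) i j (sym (m∸n+n≡m i≤j))

inject₁≢suc : ∀ {m} (i : Fin m) → inject₁ i ≢ suc i
inject₁≢suc i eq = 1+n≢n (sym (trans (sym (toℕ-inject₁ i)) (cong toℕ eq)))

disjoint-injections⇒≤ : ∀ {a b n} {f : Fin a → Fin n} {g : Fin b → Fin n}
  → Injective _≡_ _≡_ f → Injective _≡_ _≡_ g → (∀ i j → f i ≢ g j) → a + b ≤ n
disjoint-injections⇒≤ {a} {b} {f = f} {g} f-inj g-inj f≢g =
  injective⇒≤ {f = [ f , g ]′ ∘ splitAt a} λ {x} {y} eq →
    trans (sym (join-splitAt a b x))
          (trans (cong (join a b) (copair-injective (splitAt a x) (splitAt a y) eq)) (join-splitAt a b y))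
  where
  copair-injective : ∀ x y → [ f , g ]′ x ≡ [ f , g ]′ y → x ≡ y
  copair-injective (inj₁ i) (inj₁ j) eq = cong inj₁ (f-inj eq)
  copair-injective (inj₂ i) (inj₂ j) eq = cong inj₂ (g-inj eq)
  copair-injective (inj₁ i) (inj₂ j) eq = ⊥-elim (f≢g i j eq)
  copair-injective (inj₂ i) (inj₁ j) eq = ⊥-elim (f≢g j i (sym eq))

module Paths {n : ℕ} (E : Graph n) where

  _++_ : ∀ {x y z} → Path E x y → Path E y z → Path E x z
  []      ++ q = q
  (e ∷ p) ++ q = e ∷ (p ++ q)

  visits-++⁻ : ∀ {u x y z} (p : Path E x y) (q : Path E y z) → Visits E u (p ++ q) → Visits E u p ⊎ Visits E u q
  visits-++⁻ []      q u∈q       = inj₂ u∈q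
  visits-++⁻ (e ∷ p) q here      = inj₁ here
  visits-++⁻ (e ∷ p) q (there u∈) with visits-++⁻ p q u∈
  ... | inj₁ u∈p = inj₁ (there u∈p)
  ... | inj₂ u∈q = inj₂ u∈q

  visits-target : ∀ {x y} (p : Path E x y) → Visits E y p
  visits-target []      = here
  visits-target (e ∷ p) = there (visits-target p)

  visits-[]⁻ : ∀ {u x} → Visits E u ([] {x = x}) → u ≡ x
  visits-[]⁻ here = refl

  visits? : ∀ u {x y} (p : Path E x y) → Dec (Visits E u p)
  visits? u {x} p with u ≟ x
  visits? u {x} p       | yes refl = yes here
  visits? u {x} []      | no u≢x   = no (u≢x ∘ visits-[]⁻)
  visits? u {x} (e ∷ p) | no u≢x with visits? u p
  ... | yes u∈p = yes (there u∈p)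
  ... | no u∉p  = no λ { here → u≢x refl ; (there u∈p) → u∉p u∈p }

  prefix-to : ∀ {u x y} {p : Path E x y} → Visits E u p
    → Σ (Path E x u) λ q → ∀ w → Visits E w q → Visits E w p
  prefix-to here = [] , λ w w∈[] → subst (λ z → Visits E z _) (sym (visits-[]⁻ w∈[])) here
  prefix-to {p = e ∷ p} (there u∈p) with prefix-to u∈p
  ... | q , q⊆p = e ∷ q , λ { w here → here ; w (there w∈q) → there (q⊆p w w∈q) }

  MeetsOnlyAt : ∀ {x y} → (Fin n → Set) → Fin n → Path E x y → Set
  MeetsOnlyAt D z q = ∀ w → Visits E w q → D w → w ≡ z

  module _ {D : Fin n → Set} (D? : ∀ x → Dec (D x)) where

    first-hit : ∀ {u x y} (r : Path E x y) → Visits E u r → D u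
      → Σ (Fin n) λ z → D z × Σ (Path E x z) (MeetsOnlyAt D z)
    first-hit {x = x} r u∈r Du with D? x
    ... | yes Dx = x , Dx , [] , λ w w∈[] _ → visits-[]⁻ w∈[]
    first-hit r here Du | no ¬Dx = ⊥-elim (¬Dx Du)
    first-hit (e ∷ r) (there u∈r) Du | no ¬Dx with first-hit r u∈r Du
    ... | z , Dz , q , only-z = z , Dz , e ∷ q , λ { w here Dw → ⊥-elim (¬Dx Dw) ; w (there w∈q) → only-z w w∈q }

    private
      avoids-or-last-hit : ∀ {x y} (r : Path E x y) → (∀ w → Visits E w r → ¬ D w) ⊎
        Σ (Fin n) λ z → D z × Σ (Path E z y) (MeetsOnlyAt D z)
      avoids-or-last-hit {x} [] with D? x
      ... | yes Dx = inj₂ (x , Dx , [] , λ w w∈[] _ → visits-[]⁻ w∈[])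
      ... | no ¬Dx = inj₁ λ w w∈[] → subst (λ z → ¬ D z) (sym (visits-[]⁻ w∈[])) ¬Dx
      avoids-or-last-hit {x} (e ∷ r) with avoids-or-last-hit r
      ... | inj₂ hit = inj₂ hit
      ... | inj₁ avoids with D? x
      ... | yes Dx = inj₂ (x , Dx , e ∷ r , λ { w here _ → refl ; w (there w∈r) Dw → ⊥-elim (avoids w w∈r Dw) })
      ... | no ¬Dx = inj₁ λ { w here → ¬Dx ; w (there w∈r) → avoids w w∈r }

    last-hit : ∀ {u x y} (r : Path E x y) → Visits E u r → D u
      → Σ (Fin n) λ z → D z × Σ (Path E z y) (MeetsOnlyAt D z)
    last-hit r u∈r Du with avoids-or-last-hit r
    ... | inj₁ avoids = ⊥-elim (avoids _ u∈r Du)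
    ... | inj₂ hit    = hit

module Dominance {n : ℕ} (E : Graph n) (s : Fin n) (reach : AllReachable E s) where

  open Paths E

  dominates-refl : ∀ a → Dominates E s a a
  dominates-refl a = visits-target

  dominates-trans : ∀ {a b c} → Dominates E s a b → Dominates E s b c → Dominates E s a c
  dominates-trans {a} a⊑b b⊑c p with prefix-to (b⊑c p)
  ... | q , q⊆p = q⊆p a (a⊑b q)

  dominates-antisym : ∀ {a b} → Dominates E s a b → Dominates E s b a → a ≡ b
  dominates-antisym {a} {b} a⊑b b⊑a with first-hit (λ x → (x ≟ a) ⊎-dec (x ≟ b)) (reach a) (visits-target _) (inj₁ refl)
  ... | z , inj₁ refl , q , only-z = sym (only-z b (b⊑a q) (inj₂ refl))
  ... | z , inj₂ refl , q , only-z = only-z a (a⊑b q) (inj₁ refl)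

  dominates-source⇒≡ : ∀ {a} → Dominates E s a s → a ≡ s
  dominates-source⇒≡ a⊑s = visits-[]⁻ (a⊑s [])

  -- Follow the path s ⇝ v from its last visit to {x, y}: that tail, prefixed by the path
  -- to the visited vertex that avoids the other one, is a path s ⇝ v missing a dominator.
  no-mutually-avoiding-paths : ∀ {x y v} → Dominates E s x v → Dominates E s y v
    → (p : Path E s x) → ¬ Visits E y p → (q : Path E s y) → ¬ Visits E x q → ⊥
  no-mutually-avoiding-paths {x} {y} {v} x⊑v y⊑v p y∉p q x∉q
    with last-hit (λ z → (z ≟ x) ⊎-dec (z ≟ y)) (reach v) (x⊑v (reach v)) (inj₁ refl)
  ... | z , inj₁ refl , r , only-z with visits-++⁻ p r (y⊑v (p ++ r))
  ...   | inj₁ y∈p = y∉p y∈p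
  ...   | inj₂ y∈r = y∉p (subst (λ w → Visits E w p) (sym (only-z y y∈r (inj₂ refl))) (visits-target p))
  no-mutually-avoiding-paths {x} {y} {v} x⊑v y⊑v p y∉p q x∉q
      | z , inj₂ refl , r , only-z with visits-++⁻ q r (x⊑v (q ++ r))
  ...   | inj₁ x∈q = x∉q x∈q
  ...   | inj₂ x∈r = x∉q (subst (λ w → Visits E w q) (sym (only-z x x∈r (inj₁ refl))) (visits-target q))

  dominators-comparable : ∀ {x y v} → Dominates E s x v → Dominates E s y v
    → ¬ Dominates E s x y → Dominates E s y x
  dominators-comparable {x} {y} x⊑v y⊑v x⋢y p = decidable-stable (visits? y p) λ y∉p →
    x⋢y λ q → decidable-stable (visits? x q) λ x∉q →
      no-mutually-avoiding-paths x⊑v y⊑v p y∉p q x∉q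

  child⇒dominated : ∀ {a c} → ChildDT E s a c → Dominates E s a c
  child⇒dominated (_ , a⊑c , _) = a⊑c

  child-not-dominates-parent : ∀ {a c} → ChildDT E s a c → ¬ Dominates E s c a
  child-not-dominates-parent (_ , a⊑c , a≢c , _) c⊑a = a≢c (dominates-antisym a⊑c c⊑a)

  siblings-incomparable : ∀ {a c c′} → ChildDT E s a c → ChildDT E s a c′ → c ≢ c′ → ¬ Dominates E s c c′
  siblings-incomparable c-child (_ , _ , _ , idom) c≢c′ c⊑c′ =
    child-not-dominates-parent c-child (idom _ c⊑c′ c≢c′)

  record Fork (a b : Fin n) : Set where
    field
      toward           : Fin n
      toward-child     : ChildDT E s a toward
      toward-dominates : Dominates E s toward b
      other            : Fin n
      other-child      : ChildDT E s a other
      other≢toward     : other ≢ toward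

    other-escapes : ∀ {x} → Dominates E s toward x → other ≢ x
    other-escapes toward⊑x other≡x =
      siblings-incomparable toward-child other-child (other≢toward ∘ sym)
        (subst (Dominates E s toward) (sym other≡x) toward⊑x)

  module _ (dominates? : ∀ a b → Dec (Dominates E s a b)) where

    childDT? : ∀ a c → Dec (ChildDT E s a c)
    childDT? a c = ¬? (c ≟ s) ×-dec (dominates? a c ×-dec (¬? (a ≟ c) ×-dec
                     all? λ w → dominates? w c →-dec (¬? (w ≟ c) →-dec dominates? w a)))

    -- c is the first vertex on a path s ⇝ b that dominates b but not a.
    child-toward : ∀ {a b} → Dominates E s a b → a ≢ b
      → Σ (Fin n) λ c → ChildDT E s a c × Dominates E s c b
    child-toward {a} {b} a⊑b a≢b
      with first-hit (λ x → dominates? x b ×-dec ¬? (dominates? x a)) (reach b) (visits-target _)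
                     (dominates-refl b , a≢b ∘ dominates-antisym a⊑b)
    ... | c , (c⊑b , c⋢a) , q , only-c = c , (c≢s , a⊑c , a≢c , idom) , c⊑b
      where
      a⊑c : Dominates E s a c
      a⊑c = dominators-comparable c⊑b a⊑b c⋢a
      a≢c : a ≢ c
      a≢c refl = c⋢a (dominates-refl c)
      c≢s : c ≢ s
      c≢s refl = a≢c (dominates-source⇒≡ a⊑c)
      idom : ∀ w → Dominates E s w c → w ≢ c → Dominates E s w a
      idom w w⊑c w≢c = decidable-stable (dominates? w a) λ w⋢a →
        w≢c (only-c w (w⊑c q) (dominates-trans w⊑c c⊑b , w⋢a))

    second-child : ∀ {a c} → ¬ HasExactlyOneChild E s a → ChildDT E s a c
      → Σ (Fin n) λ c′ → ChildDT E s a c′ × c′ ≢ c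
    second-child {a} {c} not-one c-child with any? (λ c′ → childDT? a c′ ×-dec ¬? (c′ ≟ c))
    ... | yes found = found
    ... | no none   = ⊥-elim (not-one (c , c-child , λ c′ c′-child →
                        decidable-stable (c′ ≟ c) λ c′≢c → none (c′ , c′-child , c′≢c)))

    fork : ∀ {a b} → ¬ HasExactlyOneChild E s a → Dominates E s a b → a ≢ b → Fork a b
    fork not-one a⊑b a≢b with child-toward a⊑b a≢b
    ... | c , c-child , c⊑b with second-child not-one c-child
    ...   | c′ , c′-child , c′≢c = record
      { toward = c ; toward-child = c-child ; toward-dominates = c⊑b
      ; other = c′ ; other-child = c′-child ; other≢toward = c′≢c }

    module DominatorChain (no-only-child : ∀ u → ¬ HasExactlyOneChild E s u)
      {m : ℕ} (v : Fin (suc m) → Fin n) (v-injective : Injective _≡_ _≡_ v)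
      (v-step : ∀ i j → toℕ j ≡ suc (toℕ i) → Dominates E s (v i) (v j)) where

      v-monotone : ∀ i j → toℕ i ≤ toℕ j → Dominates E s (v i) (v j)
      v-monotone = steps⇒monotone (dominates-refl _) dominates-trans v-step

      fork-at : (i : Fin m) → Fork (v (inject₁ i)) (v (suc i))
      fork-at i = fork (no-only-child _) (v-step (inject₁ i) (suc i) suc-index)
                       (inject₁≢suc i ∘ v-injective)
        where
        suc-index : toℕ (suc i) ≡ suc (toℕ (inject₁ i))
        suc-index = cong suc (sym (toℕ-inject₁ i))

      open Fork

      w : Fin m → Fin n
      w i = other (fork-at i)

      toward-dominates-later : ∀ i j → toℕ i < toℕ j → Dominates E s (toward (fork-at i)) (v j)
      toward-dominates-later i j i<j = dominates-trans (toward-dominates (fork-at i)) (v-monotone (suc i) j i<j)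

      w≢v : ∀ i j → w i ≢ v j
      w≢v i j with ≤-<-connex (toℕ j) (toℕ i)
      ... | inj₁ j≤i = λ wᵢ≡vⱼ → child-not-dominates-parent (other-child (fork-at i))
                         (subst (λ x → Dominates E s x (v (inject₁ i))) (sym wᵢ≡vⱼ)
                                (v-monotone j (inject₁ i) (subst (toℕ j ≤_) (sym (toℕ-inject₁ i)) j≤i)))
      ... | inj₂ i<j = other-escapes (fork-at i) (toward-dominates-later i j i<j)

      w≢later : ∀ i j → toℕ i < toℕ j → w i ≢ w j
      w≢later i j i<j = other-escapes (fork-at i)
        (dominates-trans (toward-dominates-later i (inject₁ j) (subst (toℕ i <_) (sym (toℕ-inject₁ j)) i<j))
                         (child⇒dominated (other-child (fork-at j))))

      w-injective : Injective _≡_ _≡_ w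
      w-injective {i} {j} eq with <-cmp i j
      ... | tri< i<j _ _ = ⊥-elim (w≢later i j i<j eq)
      ... | tri≈ _ i≡j _ = i≡j
      ... | tri> _ _ j<i = ⊥-elim (w≢later j i j<i (sym eq))

      chain-and-forks-fit : suc m + m ≤ n
      chain-and-forks-fit = disjoint-injections⇒≤ v-injective w-injective λ j i → w≢v i j ∘ sym

  dominates-decidable-¬¬ : ¬ ¬ (∀ a b → Dec (Dominates E s a b))
  dominates-decidable-¬¬ = ¬¬-∀-Fin λ a → ¬¬-∀-Fin λ b → ¬¬-excluded-middle

twice-suc≤ : ∀ {m n} → suc m + m ≤ n → 2 * suc m ≤ n + 1
twice-suc≤ {m} {n} le = begin
  2 * suc m     ≡⟨ double m ⟩
  suc m + m + 1 ≤⟨ +-monoˡ-≤ 1 le ⟩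
  n + 1         ∎
  where
  open ≤-Reasoning
  double : ∀ m → 2 * suc m ≡ suc m + m + 1
  double = solve-∀

mainTheorem13 : (n : ℕ) (E : Graph n) (s : Fin n)
    → AllReachable E s
    → (∀ u → ¬ HasExactlyOneChild E s u)
    → (k : ℕ) (v : Fin k → Fin n)
    → Injective _≡_ _≡_ v
    → (∀ (i j : Fin k) → toℕ j ≡ suc (toℕ i) → Dominates E s (v i) (v j))
    → 2 * k ≤ n + 1
mainTheorem13 n E s reach no-only-child zero    v v-injective v-step = z≤n
mainTheorem13 n E s reach no-only-child (suc m) v v-injective v-step =
  decidable-stable (2 * suc m ≤? n + 1) λ too-long →
    dominates-decidable-¬¬ λ dominates? →
      too-long (twice-suc≤ (DominatorChain.chain-and-forks-fit dominates? no-only-child v v-injective v-step))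
  where open Dominance E s reach
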